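{- Let $d\geq 3$. If $\varphi$ is a partial $d$-edge coloring of the hypercube $Q_d$ in which every color appears on at most one edge, then $\varphi$ is avoidable.
   Context: $Q_d$ is the $d$-dimensional hypercube (vertex set $\{0,1\}^d$, two vertices adjacent iff they differ in exactly one coordinate). A partial $d$-edge coloring of $Q_d$ assigns colors from $\{1,\dots,d\}$ to some subset of edges (not necessarily properly). It is avoidable if there is a proper $d$-edge coloring $f$ of $Q_d$ with colors $1,\dots,d$ such that $f(e)\neq\varphi(e)$ for every edge $e$ colored under $\varphi$. -}

module Defs where

open import Data.Nat using (ℕ)
open import Data.Bool using (Bool; true; false)
open import Data.Fin using (Fin)
open import Data.Vec using (Vec; lookup; _[_]≔_)
open import Data.Maybe using (Maybe; just)
open import Data.Product using (Σ; _×_; _,_; proj₁)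
open import Data.Sum using (_⊎_)
open import Relation.Binary.PropositionalEquality using (_≡_; _≢_)

-- Vertices of the hypercube Q_d: {0,1}^d, with 0 = false, 1 = true.
Vertex : ℕ → Set
Vertex d = Vec Bool d

-- An edge of Q_d is determined by its lower endpoint v and the direction i
-- in which it changes, where v has coordinate i equal to 0 (false).
record Edge (d : ℕ) : Set where
  constructor edge
  field
    low    : Vertex d
    dir    : Fin d
    low-ok : lookup low dir ≡ false

open Edge public

high : ∀ {d} → Edge d → Vertex d
high e = low e [ dir e ]≔ true

_∈ₑ_ : ∀ {d} → Vertex d → Edge d → Set
u ∈ₑ e = (u ≡ low e) ⊎ (u ≡ high e)

Adjacent : ∀ {d} → Edge d → Edge d → Set
Adjacent {d} e e' = Σ (Vertex d) λ u → (u ∈ₑ e) × (u ∈ₑ e')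

-- a partial d-edge coloring: each edge receives a colour from {1..d}
-- (represented by Fin d) or no colour (nothing); not necessarily proper.
PartialColoring : ℕ → Set
PartialColoring d = Edge d → Maybe (Fin d)

Coloring : ℕ → Set
Coloring d = Edge d → Fin d

Proper : ∀ {d} → Coloring d → Set
Proper {d} f = (e e' : Edge d) → e ≢ e' → Adjacent e e' → f e ≢ f e'

Avoids : ∀ {d} → Coloring d → PartialColoring d → Set
Avoids {d} f φ = (e : Edge d) (c : Fin d) → φ e ≡ just c → f e ≢ c

Avoidable : ∀ {d} → PartialColoring d → Set
Avoidable {d} φ = Σ (Coloring d) λ f → Proper f × Avoids f φ

EachColorAtMostOnce : ∀ {d} → PartialColoring d → Set
EachColorAtMostOnce {d} φ =
  (e e' : Edge d) (c : Fin d) → φ e ≡ just c → φ e' ≡ just c → e ≡ e'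

{-# OPTIONS --safe #-}
-- Color 0 lies on at most one edge, so it is missing from
-- direction 0 or from direction 1; after swapping these two coordinates it is
-- missing from direction 0.  Give every direction-0 edge color 0; each layer
-- {x₀ = b} is a copy of Q_{d-1}, and φ restricted to it, with color 0 deleted and
-- the other colors renumbered, still uses each color at most once, so by
-- induction it is avoided by a proper coloring with the remaining d - 1 colors.
-- The induction cannot start at d = 2 (two opposite edges of the 4-cycle colored
-- differently are unavoidable); for d = 3 it suffices to try the colorings built
-- the same way from the two proper colorings of Q₂, possibly with coordinates
-- 0 and 1 swapped; this is checked by evaluation, as φ is determined by the
-- positions of its three colors.
module Submission where

open import Defs
open import Axiom.UniquenessOfIdentityProofs using (module Decidable⇒UIP)
open import Data.Bool using (Bool; true; false; if_then_else_)
open import Data.Bool.Properties using () renaming (_≟_ to _≟ᵇ_)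
open import Data.Fin using (Fin; zero; suc; punchIn; punchOut; _≟_)
open import Data.Fin.Patterns using (0F; 1F; 2F)
open import Data.Fin.Properties
  using (any?; suc-injective; punchIn-injective; punchInᵢ≢i; punchIn-punchOut; punchOut-cong′)
open import Data.Fin.Subset.Properties using (anySubset?)
open import Data.Maybe using (Maybe; just; nothing)
open import Data.Maybe.Properties using (just-injective) renaming (≡-dec to ≡-dec-Maybe)
open import Data.Maybe.Relation.Unary.All as All using (All; just; nothing)
open import Data.Nat using (ℕ; zero; suc; _+_; _≥_; s≤s)
open import Data.Product using (∃; ∃-syntax; _×_; _,_; proj₁; proj₂)
open import Data.Sum using (inj₁; inj₂)
open import Data.Vec using ([]; _∷_; head; tail)
open import Data.Vec.Properties using () renaming (≡-dec to ≡-dec-Vec)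
open import Function using (_∘_; _$_; case_of_)
open import Relation.Binary.Definitions using (DecidableEquality)
open import Relation.Binary.PropositionalEquality
open import Relation.Nullary using (Dec; yes; no; contradiction)
open import Relation.Nullary.Decidable using (map′; ¬?; _×-dec_; _→-dec_; from-yes; decidable-stable)
open import Relation.Unary using (Decidable)

OnceColoringsAvoidable : ℕ → Set
OnceColoringsAvoidable d = (φ : PartialColoring d) → EachColorAtMostOnce φ → Avoidable φ

edge-≡ : ∀ {d} {e e' : Edge d} → low e ≡ low e' → dir e ≡ dir e' → e ≡ e'
edge-≡ {e = edge v i ok} {edge .v .i ok'} refl refl =
  cong (edge v i) (Decidable⇒UIP.≡-irrelevant _≟ᵇ_ ok ok')

_≟ₑ_ : ∀ {d} → DecidableEquality (Edge d)
e ≟ₑ e' = map′ (λ (p , q) → edge-≡ p q) (λ { refl → refl , refl })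
  (≡-dec-Vec _≟ᵇ_ (low e) (low e') ×-dec (dir e ≟ dir e'))

∃-≡false? : ∀ {b} {Q : b ≡ false → Set} → ((ok : b ≡ false) → Dec (Q ok)) → Dec (∃ Q)
∃-≡false? {false} Q? = map′ (refl ,_) (λ { (refl , q) → q }) (Q? refl)
∃-≡false? {true}  Q? = no λ ()

any-edge? : ∀ {d} {P : Edge d → Set} → Decidable P → Dec (∃ P)
any-edge? {d} {P} P? = map′ {A = ∃[ v ] ∃[ i ] ∃ λ ok → P (edge v i ok)}
  (λ (v , i , ok , p) → edge v i ok , p) (λ (edge v i ok , p) → v , i , ok , p)
  (anySubset? λ v → any? λ i → ∃-≡false? (P? ∘ edge v i))

all-edges? : ∀ {d} {P : Edge d → Set} → Decidable P → Dec (∀ e → P e)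
all-edges? P? = map′ (λ ∄ e → decidable-stable (P? e) (λ ¬p → ∄ (e , ¬p))) (λ ∀p (e , ¬p) → ¬p (∀p e))
  (¬? (any-edge? (¬? ∘ P?)))

∀-maybe? : ∀ {A : Set} {P : Maybe A → Set} → Dec (P nothing) → Dec (∀ x → P (just x)) → Dec (∀ m → P m)
∀-maybe? p? ∀p? = map′ (λ { (p , ∀p) nothing → p ; (p , ∀p) (just x) → ∀p x }) (λ ∀p → ∀p nothing , ∀p ∘ just)
  (p? ×-dec ∀p?)

layer : ∀ {n} → Bool → Edge n → Edge (suc n)
layer b (edge v i ok) = edge (b ∷ v) (suc i) ok

layer-injective : ∀ {n} b {e e' : Edge n} → layer b e ≡ layer b e' → e ≡ e'
layer-injective b {edge _ _ _} {edge _ _ _} eq = edge-≡ (cong (tail ∘ low) eq) (suc-injective (cong dir eq))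

∈-layer : ∀ {n} {b} {e : Edge n} {u} → u ∈ₑ layer b e → head u ≡ b × tail u ∈ₑ e
∈-layer {e = edge _ _ _} (inj₁ refl) = refl , inj₁ refl
∈-layer {e = edge _ _ _} (inj₂ refl) = refl , inj₂ refl

∈-direction₀ : ∀ {n} {b} {v : Vertex n} {ok} {u} → u ∈ₑ edge (b ∷ v) zero ok → tail u ≡ v
∈-direction₀ (inj₁ refl) = refl
∈-direction₀ (inj₂ refl) = refl

stack : ∀ {n} → Fin (suc n) → (Bool → Coloring n) → Coloring (suc n)
stack c g (edge (b ∷ v) zero    ok) = c
stack c g (edge (b ∷ v) (suc i) ok) = punchIn c (g b (edge v i ok))

stack-proper : ∀ {n} c (g : Bool → Coloring n) → (∀ b → Proper (g b)) → Proper (stack c g)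
stack-proper c g _ (edge (_ ∷ _) zero ok) (edge (_ ∷ _) zero ok') e≢e' (u , u∈e , u∈e') _ =
  e≢e' (edge-≡ (cong₂ _∷_ (trans ok (sym ok'))
                          (trans (sym (∈-direction₀ {ok = ok} u∈e)) (∈-direction₀ {ok = ok'} u∈e')))
               refl)
stack-proper c g _ (edge (_ ∷ _) zero _) (edge (b ∷ v) (suc i) ok) _ _ =
  punchInᵢ≢i c (g b (edge v i ok)) ∘ sym
stack-proper c g _ (edge (b ∷ v) (suc i) ok) (edge (_ ∷ _) zero _) _ _ =
  punchInᵢ≢i c (g b (edge v i ok))
stack-proper c g g-proper (edge (b ∷ v) (suc i) ok) (edge (b' ∷ v') (suc i') ok') e≢e' (u , u∈e , u∈e')
  with ∈-layer {e = edge v i ok} u∈e | ∈-layer {e = edge v' i' ok'} u∈e'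
... | refl , u∈d | refl , u∈d' =
  g-proper (head u) _ _ (e≢e' ∘ cong (layer (head u))) (tail u , u∈d , u∈d') ∘ punchIn-injective c _ _

removeColor : ∀ {n} → Fin (suc n) → Maybe (Fin (suc n)) → Maybe (Fin n)
removeColor c nothing = nothing
removeColor c (just x) with c ≟ x
... | yes _   = nothing
... | no c≢x = just (punchOut c≢x)

removeColor-just : ∀ {n} c m {y : Fin n} → removeColor c m ≡ just y → m ≡ just (punchIn c y)
removeColor-just c (just x) eq with c ≟ x
... | no c≢x = cong just (trans (sym (punchIn-punchOut c≢x)) (cong (punchIn c) (just-injective eq)))

removeColor-≢ : ∀ {n} {c x : Fin (suc n)} (c≢x : c ≢ x) → removeColor c (just x) ≡ just (punchOut c≢x)
removeColor-≢ {c = c} {x} c≢x with c ≟ x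
... | yes c≡x = contradiction c≡x c≢x
... | no _    = cong just (punchOut-cong′ c refl)

layerColoring : ∀ {n} → Fin (suc n) → PartialColoring (suc n) → Bool → PartialColoring n
layerColoring c φ b = removeColor c ∘ φ ∘ layer b

layerColoring-once : ∀ {n} c {φ : PartialColoring (suc n)} b →
  EachColorAtMostOnce φ → EachColorAtMostOnce (layerColoring c φ b)
layerColoring-once c b once e e' y φe φe' =
  layer-injective b (once _ _ (punchIn c y) (removeColor-just c _ φe) (removeColor-just c _ φe'))

MissingInDirection₀ : ∀ {n} → PartialColoring (suc n) → Fin (suc n) → Set
MissingInDirection₀ φ c = ∀ e → dir e ≡ zero → φ e ≢ just c

stack-avoids : ∀ {n} c {φ : PartialColoring (suc n)} (g : Bool → Coloring n) →
  MissingInDirection₀ φ c → (∀ b → Avoids (g b) (layerColoring c φ b)) → Avoids (stack c g) φ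
stack-avoids c g missing _ (edge (_ ∷ _) zero _) _ φe refl = missing _ refl φe
stack-avoids c g _ g-avoids (edge (b ∷ v) (suc i) ok) x φe with c ≟ x
... | yes refl = punchInᵢ≢i c (g b (edge v i ok))
... | no c≢x   = λ eq → g-avoids b (edge v i ok) (punchOut c≢x)
                   (trans (cong (removeColor c) φe) (removeColor-≢ c≢x))
                   (punchIn-injective c _ _ (trans eq (sym (punchIn-punchOut c≢x))))

missingInDirection₀⇒avoidable : ∀ {n} → OnceColoringsAvoidable n →
  (φ : PartialColoring (suc n)) → EachColorAtMostOnce φ → ∀ c → MissingInDirection₀ φ c → Avoidable φ
missingInDirection₀⇒avoidable avoidable φ once c missing =
  stack c g ,
  stack-proper c g (proj₁ ∘ proj₂ ∘ layer-avoidable) ,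
  stack-avoids c g missing (proj₂ ∘ proj₂ ∘ layer-avoidable)
  where
  layer-avoidable : ∀ b → Avoidable (layerColoring c φ b)
  layer-avoidable b = avoidable (layerColoring c φ b) (layerColoring-once c b once)

  g : Bool → Coloring _
  g = proj₁ ∘ layer-avoidable

swap : ∀ {n} → Vertex (2 + n) → Vertex (2 + n)
swap (a ∷ b ∷ v) = b ∷ a ∷ v

swapEdge : ∀ {n} → Edge (2 + n) → Edge (2 + n)
swapEdge (edge (a ∷ b ∷ v) 0F            ok) = edge (b ∷ a ∷ v) 1F            ok
swapEdge (edge (a ∷ b ∷ v) 1F            ok) = edge (b ∷ a ∷ v) 0F            ok
swapEdge (edge (a ∷ b ∷ v) (suc (suc i)) ok) = edge (b ∷ a ∷ v) (suc (suc i)) ok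

swapEdge-involutive : ∀ {n} (e : Edge (2 + n)) → swapEdge (swapEdge e) ≡ e
swapEdge-involutive (edge (_ ∷ _ ∷ _) 0F            _) = refl
swapEdge-involutive (edge (_ ∷ _ ∷ _) 1F            _) = refl
swapEdge-involutive (edge (_ ∷ _ ∷ _) (suc (suc _)) _) = refl

swapEdge-injective : ∀ {n} {e e' : Edge (2 + n)} → swapEdge e ≡ swapEdge e' → e ≡ e'
swapEdge-injective {e = e} {e'} eq =
  trans (sym (swapEdge-involutive e)) (trans (cong swapEdge eq) (swapEdge-involutive e'))

swapEdge-endpoints : ∀ {n} (e : Edge (2 + n)) → low (swapEdge e) ≡ swap (low e) × high (swapEdge e) ≡ swap (high e)
swapEdge-endpoints (edge (_ ∷ _ ∷ _) 0F            _) = refl , refl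
swapEdge-endpoints (edge (_ ∷ _ ∷ _) 1F            _) = refl , refl
swapEdge-endpoints (edge (_ ∷ _ ∷ _) (suc (suc _)) _) = refl , refl

swap-∈ₑ : ∀ {n} {u} (e : Edge (2 + n)) → u ∈ₑ e → swap u ∈ₑ swapEdge e
swap-∈ₑ e (inj₁ refl) = inj₁ (sym (proj₁ (swapEdge-endpoints e)))
swap-∈ₑ e (inj₂ refl) = inj₂ (sym (proj₂ (swapEdge-endpoints e)))

swapEdge-direction₀ : ∀ {n} (e : Edge (2 + n)) → dir e ≡ 0F → dir (swapEdge e) ≡ 1F
swapEdge-direction₀ (edge (_ ∷ _ ∷ _) 0F _) _ = refl

proper-∘swapEdge : ∀ {n} {f : Coloring (2 + n)} → Proper f → Proper (f ∘ swapEdge)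
proper-∘swapEdge f-proper e e' e≢e' (u , u∈e , u∈e') =
  f-proper (swapEdge e) (swapEdge e') (e≢e' ∘ swapEdge-injective) (swap u , swap-∈ₑ e u∈e , swap-∈ₑ e' u∈e')

once-∘swapEdge : ∀ {n} {φ : PartialColoring (2 + n)} → EachColorAtMostOnce φ → EachColorAtMostOnce (φ ∘ swapEdge)
once-∘swapEdge once e e' c φe φe' = swapEdge-injective (once _ _ c φe φe')

avoidable-∘swapEdge : ∀ {n} {φ : PartialColoring (2 + n)} → Avoidable (φ ∘ swapEdge) → Avoidable φ
avoidable-∘swapEdge {φ = φ} (f , f-proper , f-avoids) =
  f ∘ swapEdge , proper-∘swapEdge f-proper ,
  λ e c φe → f-avoids (swapEdge e) c (trans (cong φ (swapEdge-involutive e)) φe)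

avoidable-suc : ∀ {n} → OnceColoringsAvoidable (suc n) → OnceColoringsAvoidable (2 + n)
avoidable-suc avoidable φ once with any-edge? (λ e → (dir e ≟ 0F) ×-dec (≡-dec-Maybe _≟_ (φ e) (just 0F)))
... | no ∄ = missingInDirection₀⇒avoidable avoidable φ once 0F λ e d₀ φe → ∄ (e , d₀ , φe)
... | yes (e₀ , d₀ , φe₀) = avoidable-∘swapEdge $
  missingInDirection₀⇒avoidable avoidable (φ ∘ swapEdge) (once-∘swapEdge once) 0F λ e d₀′ φe →
    case trans (sym (swapEdge-direction₀ e d₀′)) (trans (cong dir (once _ _ _ φe φe₀)) d₀) of λ ()

AvoidsAt : ∀ {d} → Coloring d → Fin d → Maybe (Edge d) → Set
AvoidsAt f c = All (λ e → f e ≢ c)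

Apart : ∀ {d} → Maybe (Edge d) → Maybe (Edge d) → Set
Apart a b = All (λ e → All (e ≢_) b) a

colorPosition : ∀ {d} → PartialColoring d → Fin d → Maybe (Edge d)
colorPosition φ c with any-edge? (λ e → ≡-dec-Maybe _≟_ (φ e) (just c))
... | yes (e , _) = just e
... | no _        = nothing

colorPosition-colored : ∀ {d} (φ : PartialColoring d) c → All (λ e → φ e ≡ just c) (colorPosition φ c)
colorPosition-colored φ c with any-edge? (λ e → ≡-dec-Maybe _≟_ (φ e) (just c))
... | yes (_ , φe) = just φe
... | no _         = nothing

colorPosition-complete : ∀ {d} {φ : PartialColoring d} → EachColorAtMostOnce φ →
  ∀ {e c} → φ e ≡ just c → colorPosition φ c ≡ just e
colorPosition-complete {φ = φ} once {e} {c} φe with any-edge? (λ e → ≡-dec-Maybe _≟_ (φ e) (just c))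
... | yes (e' , φe') = cong just (once e' e c φe' φe)
... | no ∄           = contradiction (e , φe) ∄

colorPosition-apart : ∀ {d} (φ : PartialColoring d) {c c'} → c ≢ c' → Apart (colorPosition φ c) (colorPosition φ c')
colorPosition-apart φ {c} {c'} c≢c' = apart (colorPosition-colored φ c) (colorPosition-colored φ c')
  where
  apart : ∀ {a b} → All (λ e → φ e ≡ just c) a → All (λ e → φ e ≡ just c') b → Apart a b
  apart nothing   _           = nothing
  apart (just _)  nothing     = just nothing
  apart (just φe) (just φe')  = just (just λ { refl → c≢c' (just-injective (trans (sym φe) φe')) })

avoids-colorPositions : ∀ {d} {φ : PartialColoring d} {f : Coloring d} → EachColorAtMostOnce φ →
  (∀ c → AvoidsAt f c (colorPosition φ c)) → Avoids f φ
avoids-colorPositions once avoidsAt e c φe =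
  All.drop-just (subst (All _) (colorPosition-complete once φe) (avoidsAt c))

edge₁-unique : (e e' : Edge 1) → e ≡ e'
edge₁-unique (edge (true ∷ []) 0F ()) _
edge₁-unique _ (edge (true ∷ []) 0F ())
edge₁-unique (edge (false ∷ []) 0F _) (edge (false ∷ []) 0F _) = edge-≡ refl refl

classColoring₂ : Fin 2 → Coloring 2
classColoring₂ c = stack c λ _ _ → 0F

classColoring₂-proper : ∀ c → Proper (classColoring₂ c)
classColoring₂-proper c = stack-proper c _ λ _ e e' e≢e' _ _ → e≢e' (edge₁-unique e e')

candidate₃ : Fin 2 → Fin 3 → Fin 2 → Fin 2 → Coloring 3
candidate₃ 0F c c₀ c₁ = stack c λ b → classColoring₂ (if b then c₁ else c₀)
candidate₃ 1F c c₀ c₁ = candidate₃ 0F c c₀ c₁ ∘ swapEdge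

candidate₃-proper : ∀ i c c₀ c₁ → Proper (candidate₃ i c c₀ c₁)
candidate₃-proper 0F c c₀ c₁ = stack-proper c _ λ b → classColoring₂-proper (if b then c₁ else c₀)
candidate₃-proper 1F c c₀ c₁ = proper-∘swapEdge (candidate₃-proper 0F c c₀ c₁)

Q₃-positions-avoidable : ∀ p₀ p₁ p₂ → Apart p₀ p₁ → Apart p₀ p₂ → Apart p₁ p₂ →
  ∃[ i ] ∃[ c ] ∃[ c₀ ] ∃[ c₁ ] let f = candidate₃ i c c₀ c₁ in AvoidsAt f 0F p₀ × AvoidsAt f 1F p₁ × AvoidsAt f 2F p₂
Q₃-positions-avoidable = from-yes $
  ∀-maybe-edge? λ p₀ → ∀-maybe-edge? λ p₁ → ∀-maybe-edge? λ p₂ →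
    apart? p₀ p₁ →-dec apart? p₀ p₂ →-dec apart? p₁ p₂ →-dec
    any? λ i → any? λ c → any? λ c₀ → any? λ c₁ → let f = candidate₃ i c c₀ c₁ in
      avoidsAt? f 0F p₀ ×-dec avoidsAt? f 1F p₁ ×-dec avoidsAt? f 2F p₂
  where
  ∀-maybe-edge? : {P : Maybe (Edge 3) → Set} → Decidable P → Dec (∀ m → P m)
  ∀-maybe-edge? P? = ∀-maybe? (P? nothing) (all-edges? (P? ∘ just))

  apart? : ∀ a b → Dec (Apart a b)
  apart? a b = All.dec (λ e → All.dec (λ e' → ¬? (e ≟ₑ e')) b) a

  avoidsAt? : ∀ f c p → Dec (AvoidsAt f c p)
  avoidsAt? f c = All.dec λ e → ¬? (f e ≟ c)

Q₃-avoidable : OnceColoringsAvoidable 3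
Q₃-avoidable φ once =
  let i , c , c₀ , c₁ , avoids₀ , avoids₁ , avoids₂ =
        Q₃-positions-avoidable (colorPosition φ 0F) (colorPosition φ 1F) (colorPosition φ 2F)
          (colorPosition-apart φ λ ()) (colorPosition-apart φ λ ()) (colorPosition-apart φ λ ())
  in candidate₃ i c c₀ c₁ , candidate₃-proper i c c₀ c₁ ,
     avoids-colorPositions once λ { 0F → avoids₀ ; 1F → avoids₁ ; 2F → avoids₂ }

avoidable-3+ : ∀ m → OnceColoringsAvoidable (3 + m)
avoidable-3+ zero    = Q₃-avoidable
avoidable-3+ (suc m) = avoidable-suc (avoidable-3+ m)

lemma3p5 : (d : ℕ) → d ≥ 3 → (φ : PartialColoring d) →
    EachColorAtMostOnce φ → Avoidable φ
lemma3p5 (suc (suc (suc m))) (s≤s (s≤s (s≤s _))) = avoidable-3+ m
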